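{- Let $X$ be a connected graph. Then there is a constant $k_X$ such that every connected $X$-free graph $G$ satisfies $rvc(G)\leq diam(G)+k_X$ if and only if $X=P_3$ or $X=P_4$.
   Context: All graphs are simple, finite, undirected. For a graph $G$ with a vertex-coloring $c:V(G)\to\{0,1,\dots,t\}$ (adjacent vertices may share colors), a path is vertex-rainbow if its internal vertices have pairwise distinct colors; $G$ is rainbow vertex-connected if every two distinct vertices are joined by a vertex-rainbow path. For a connected graph $G$, $rvc(G)$ is the minimum number of colors in a vertex-coloring making $G$ rainbow vertex-connected (complete graphs are assumed to have $rvc=0$). $diam(G)$ is the diameter of $G$. $P_k$ denotes the path on $k$ vertices. A graph $G$ is $X$-free if it contains no induced subgraph isomorphic to $X$. -}

module Defs where

open import Data.Nat using (ℕ; zero; suc; _+_; _≤_; _≡ᵇ_)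
open import Data.Fin using (Fin; toℕ)
open import Data.Bool using (Bool; T; _∨_)
open import Data.Bool.Properties using (∨-comm; T-∨)
open import Data.List using (List; []; _∷_; _++_; map; length)
open import Data.List.Relation.Unary.Linked using (Linked)
open import Data.List.Relation.Unary.Unique.Propositional using (Unique)
open import Data.Product using (Σ; _×_; ∃-syntax)
open import Data.Sum using (_⊎_; inj₁; inj₂)
open import Data.Empty using (⊥)
open import Function.Definitions using (Injective)
open import Function.Bundles using (_⇔_; Equivalence)
open import Relation.Nullary using (¬_)
open import Relation.Binary.PropositionalEquality using (_≡_; _≢_)

record Graph : Set where
  field
    order  : ℕ
    adj    : Fin order → Fin order → Bool
    sym    : ∀ u v → T (adj u v) → T (adj v u)
    irrefl : ∀ u → ¬ T (adj u u)

open Graph public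

V : Graph → Set
V G = Fin (order G)

Adj : (G : Graph) → V G → V G → Set
Adj G u v = T (adj G u v)

record Path (G : Graph) (u v : V G) : Set where
  field
    internal : List (V G)
    linked   : Linked (Adj G) (u ∷ internal ++ v ∷ [])
    distinct : Unique (u ∷ internal ++ v ∷ [])

open Path public

len : ∀ {G u v} → Path G u v → ℕ
len p = suc (length (internal p))

Connected : Graph → Set
Connected G = (1 ≤ order G) × (∀ u v → u ≢ v → Path G u v)

IsComplete : Graph → Set
IsComplete G = ∀ u v → u ≢ v → Adj G u v

DistLe : (G : Graph) → V G → V G → ℕ → Set
DistLe G u v d = (u ≡ v) ⊎ (Σ (Path G u v) λ p → len p ≤ d)

IsDiam : Graph → ℕ → Set
IsDiam G d =
  (∀ u v → DistLe G u v d) ×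
  (∃[ u ] ∃[ v ] (∀ e → DistLe G u v e → d ≤ e))

Rainbow : ∀ {G u v} {C : Set} → (V G → C) → Path G u v → Set
Rainbow c p = Unique (map c (internal p))

RainbowVertexConnected : (G : Graph) {C : Set} → (V G → C) → Set
RainbowVertexConnected G c =
  ∀ u v → u ≢ v → Σ (Path G u v) λ p → Rainbow {G} c p

-- rvc(G) ≤ m : G is complete (rvc = 0 by convention), or some
-- vertex-coloring with (at most) m colors makes G rainbow vertex-connected.
RvcLe : Graph → ℕ → Set
RvcLe G m = IsComplete G ⊎ Σ (V G → Fin m) λ c → RainbowVertexConnected G c

InducedSub : Graph → Graph → Set
InducedSub X G =
  Σ (V X → V G) λ f → Injective _≡_ _≡_ f ×
    (∀ i j → Adj X i j ⇔ Adj G (f i) (f j))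

Free : Graph → Graph → Set
Free X G = ¬ InducedSub X G

record _≅_ (G H : Graph) : Set where
  field
    to      : V G → V H
    from    : V H → V G
    from∘to : ∀ x → from (to x) ≡ x
    to∘from : ∀ y → to (from y) ≡ y
    adj-iff : ∀ u v → Adj G u v ⇔ Adj H (to u) (to v)

pathAdj : ∀ {k} → Fin k → Fin k → Bool
pathAdj i j = (suc (toℕ i) ≡ᵇ toℕ j) ∨ (suc (toℕ j) ≡ᵇ toℕ i)

private
  sucᵇ : ∀ n → ¬ T (suc n ≡ᵇ n)
  sucᵇ zero ()
  sucᵇ (suc n) h = sucᵇ n h

  pathSym : ∀ {k} (i j : Fin k) → T (pathAdj i j) → T (pathAdj j i)
  pathSym i j h rewrite ∨-comm (suc (toℕ i) ≡ᵇ toℕ j) (suc (toℕ j) ≡ᵇ toℕ i) = h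

  pathIrr : ∀ {k} (i : Fin k) → ¬ T (pathAdj i i)
  pathIrr i h with T-∨ .Equivalence.to h
  ... | inj₁ x = sucᵇ (toℕ i) x
  ... | inj₂ x = sucᵇ (toℕ i) x

P : ℕ → Graph
P k = record { order = k ; adj = pathAdj ; sym = pathSym ; irrefl = pathIrr }

-- If X is P₃ or P₄, every X-free graph is P₄-free, and in a connected P₄-free graph
-- any two vertices are joined by a path with at most one internal vertex, so a single
-- colour makes it rainbow vertex-connected.
--
-- Conversely, attach a pendant vertex to every vertex of Kₙ (giving Hₙ, of diameter 3)
-- or to every leaf of the star K₁,ₙ (giving Sₙ, of diameter 4).  Every path between two
-- pendants runs through both their anchors, so by pigeonhole rvc ≥ n.  Hence, for a
-- constant k, X must be an induced subgraph of S₅₊ₖ, hence triangle-free, and of H₄₊ₖ.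
-- A connected triangle-free induced subgraph of Hₙ with at least three vertices meets
-- at most two clique vertices, so it lies in a pendant–clique–clique–pendant path and
-- is P₃ or P₄.

module Submission where

open import Defs
open import Data.Nat using (ℕ; zero; suc; _+_; _≤_; _<_; z≤n; s≤s)
open import Data.Nat.Properties
  using (≤-refl; ≤-reflexive; ≤-trans; n≤1+n; m≤n+m; m≤m+n; +-monoˡ-≤; +-monoʳ-≤; +-suc;
         +-identityʳ; module ≤-Reasoning)
open import Data.Fin using (Fin; zero; suc; inject₁; inject≤; splitAt; _↑ˡ_; _↑ʳ_)
open import Data.Fin.Patterns using (0F; 1F; 2F; 3F)
open import Data.Fin.Properties
  using (_≟_; any?; all?; suc-injective; inject₁-injective; toℕ-inject₁; inject≤-injective;
         ↑ˡ-injective; ↑ʳ-injective; splitAt-↑ˡ; splitAt-↑ʳ; join-splitAt; pigeonhole; <⇒≢)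
open import Data.Bool using (Bool; true; false; T; not)
open import Data.Bool.Properties using (T?)
open import Data.List using (List; []; _∷_; _++_; map; length; lookup)
open import Data.List.Relation.Unary.Linked using (Linked; [-]; _∷_)
open import Data.List.Relation.Unary.AllPairs using ([]; _∷_)
open import Data.List.Relation.Unary.All using ([]; _∷_)
import Data.List.Relation.Unary.All as All
import Data.List.Relation.Unary.All.Properties as All
open import Data.List.Relation.Unary.Any using (here; there)
open import Data.List.Relation.Unary.Unique.Propositional using (Unique)
open import Data.List.Relation.Unary.Unique.Propositional.Properties using (take⁺)
open import Data.List.Membership.Propositional using (_∈_)
open import Data.List.Membership.Propositional.Properties using (∈-map⁺; ∈-lookup)
open import Data.Vec using (Vec; []; _∷_; tabulate)
import Data.Vec as Vec
open import Data.Vec.Properties using (lookup∘tabulate)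
open import Data.Product using (Σ; Σ-syntax; ∃-syntax; _×_; _,_; proj₁; proj₂)
open import Data.Sum using (_⊎_; inj₁; inj₂)
open import Data.Empty using (⊥; ⊥-elim)
open import Data.Unit using (tt)
open import Function using (_∘_; id)
open import Function.Bundles using (_⇔_; mk⇔; Equivalence)
import Function.Properties.Equivalence as ⇔
open import Relation.Nullary using (¬_; Dec; yes; no; contradiction)
open import Relation.Nullary.Decidable
  using (⌊_⌋; toWitness; fromWitness; toWitnessFalse; fromWitnessFalse; map′; _×-dec_; _→-dec_)
open import Relation.Binary.PropositionalEquality as ≡
  using (_≡_; _≢_; refl; trans; cong; subst; subst₂; ≢-sym)

private
  variable
    A B : Set
    G : Graph

first-edge : {R : A → A → Set} → ∀ u xs v → Linked R (u ∷ xs ++ v ∷ []) →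
  R u v ⊎ ∃[ w ] (w ∈ xs × R u w)
first-edge u []       v (r ∷ _) = inj₁ r
first-edge u (x ∷ xs) v (r ∷ _) = inj₂ (x , here refl , r)

last-edge : {R : A → A → Set} → ∀ u xs v → Linked R (u ∷ xs ++ v ∷ []) →
  R u v ⊎ ∃[ w ] (w ∈ xs × R w v)
last-edge u []       v (r ∷ _) = inj₁ r
last-edge u (x ∷ xs) v (_ ∷ l) with last-edge x xs v l
... | inj₁ r             = inj₂ (x , here refl , r)
... | inj₂ (w , w∈ , r)  = inj₂ (w , there w∈ , r)

Unique-map⇒≡ : (f : A → B) {xs : List A} {x y : A} → Unique (map f xs) →
  x ∈ xs → y ∈ xs → f x ≡ f y → x ≡ y
Unique-map⇒≡ f (_ ∷ _)     (here refl) (here refl) _ = refl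
Unique-map⇒≡ f (fx∉ ∷ _)   (here refl) (there y∈)  e = ⊥-elim (All.lookup fx∉ (∈-map⁺ f y∈) e)
Unique-map⇒≡ f (fy∉ ∷ _)   (there x∈)  (here refl) e =
  ⊥-elim (All.lookup fy∉ (∈-map⁺ f x∈) (≡.sym e))
Unique-map⇒≡ f (_ ∷ uniq)  (there x∈)  (there y∈)  e = Unique-map⇒≡ f uniq x∈ y∈ e

lookup-injective : {xs : List A} → Unique xs → ∀ i j → lookup xs i ≡ lookup xs j → i ≡ j
lookup-injective (_ ∷ _)    zero    zero    _ = refl
lookup-injective (x∉ ∷ _)   zero    (suc j) e = ⊥-elim (All.lookup x∉ (∈-lookup j) e)
lookup-injective (x∉ ∷ _)   (suc i) zero    e = ⊥-elim (All.lookup x∉ (∈-lookup i) (≡.sym e))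
lookup-injective (_ ∷ uniq) (suc i) (suc j) e = cong suc (lookup-injective uniq i j e)

Unique-drop : ∀ xs {y : A} {ys} → Unique (xs ++ y ∷ ys) → Unique (xs ++ ys)
Unique-drop []       (_ ∷ uniq)   = uniq
Unique-drop (x ∷ xs) (x∉ ∷ uniq) =
  All.++⁺ (All.++⁻ˡ xs x∉) (All.tail (All.++⁻ʳ xs x∉)) ∷ Unique-drop xs uniq

Lipschitz : (G : Graph) → (V G → ℕ) → Set
Lipschitz G h = ∀ {x y} → Adj G x y → h y ≤ suc (h x)

Linked-Lipschitz : {R : A → A → Set} (h : A → ℕ) → (∀ {x y} → R x y → h y ≤ suc (h x)) →
  ∀ u xs v → Linked R (u ∷ xs ++ v ∷ []) → h v ≤ suc (length xs) + h u
Linked-Lipschitz h L u []       v (r ∷ _) = L r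
Linked-Lipschitz h L u (x ∷ xs) v (r ∷ l) = begin
  h v                            ≤⟨ Linked-Lipschitz h L x xs v l ⟩
  suc (length xs) + h x          ≤⟨ +-monoʳ-≤ (suc (length xs)) (L r) ⟩
  suc (length xs) + suc (h u)    ≡⟨ +-suc (suc (length xs)) (h u) ⟩
  suc (length (x ∷ xs)) + h u    ∎
  where open ≤-Reasoning

DistLe-Lipschitz : ∀ {h u v e} → Lipschitz G h → DistLe G u v e → h v ≤ e + h u
DistLe-Lipschitz {e = e} L (inj₁ refl) = m≤n+m _ e
DistLe-Lipschitz {G} {h} {u} {v} L (inj₂ (p , p≤e)) =
  ≤-trans (Linked-Lipschitz h L u (internal p) v (linked p)) (+-monoˡ-≤ (h u) p≤e)

DistLe-along : ∀ {u v d} xs → Linked (Adj G) (u ∷ xs ++ v ∷ []) → Unique (u ∷ xs ++ v ∷ []) →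
  suc (length xs) ≤ d → DistLe G u v d
DistLe-along xs l uniq ≤d = inj₂ (record { internal = xs ; linked = l ; distinct = uniq } , ≤d)

IsDiam-by-Lipschitz : ∀ {d h u v} → (∀ x y → DistLe G x y d) →
  Lipschitz G h → h u ≡ 0 → h v ≡ d → IsDiam G d
IsDiam-by-Lipschitz {G} {d} {h} {u} {v} dist L hu≡0 hv≡d = dist , u , v , far
  where
  far : ∀ e → DistLe G u v e → d ≤ e
  far e δ = subst₂ _≤_ hv≡d (trans (cong (e +_) hu≡0) (+-identityʳ e)) (DistLe-Lipschitz L δ)

DistLe⇒Connected : ∀ {d} → 1 ≤ order G → (∀ x y → DistLe G x y d) → Connected G
DistLe⇒Connected {G} 1≤n dist = 1≤n , λ u v u≢v → path (dist u v) u≢v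
  where
  path : ∀ {u v d} → DistLe G u v d → u ≢ v → Path G u v
  path (inj₁ u≡v)     u≢v = ⊥-elim (u≢v u≡v)
  path (inj₂ (p , _)) _   = p

Rainbow-forced : {C : Set} (c : V G → C) {u v x y : V G} → ¬ Adj G u v →
  (∀ {w} → Adj G u w → w ≡ x) → (∀ {w} → Adj G w v → w ≡ y) →
  (p : Path G u v) → Rainbow {G} c p → c x ≡ c y → x ≡ y
Rainbow-forced c {u} {v} ¬uv only-x only-y p rainbow cx≡cy
  with first-edge u (internal p) v (linked p) | last-edge u (internal p) v (linked p)
... | inj₁ uv | _       = ⊥-elim (¬uv uv)
... | inj₂ _  | inj₁ uv = ⊥-elim (¬uv uv)
... | inj₂ (w , w∈ , uw) | inj₂ (w′ , w′∈ , w′v) with only-x uw | only-y w′v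
...   | refl | refl = Unique-map⇒≡ c rainbow w∈ w′∈ cx≡cy

InducedSub-trans : ∀ {X Y Z} → InducedSub X Y → InducedSub Y Z → InducedSub X Z
InducedSub-trans (f , f-inj , f-adj) (g , g-inj , g-adj) =
  g ∘ f , (λ e → f-inj (g-inj e)) , λ i j → ⇔.trans (f-adj i j) (g-adj (f i) (f j))

≅⇒InducedSub : ∀ {X Y} → X ≅ Y → InducedSub X Y
≅⇒InducedSub iso = to , to-injective , adj-iff
  where
  open _≅_ iso
  to-injective : ∀ {x y} → to x ≡ to y → x ≡ y
  to-injective {x} {y} e = trans (≡.sym (from∘to x)) (trans (cong from e) (from∘to y))

P-suc-adj : ∀ {k} (i j : Fin k) → Adj (P k) i j ⇔ Adj (P (suc k)) (suc i) (suc j)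
P-suc-adj i j = ⇔.refl

P-inject₁-adj : ∀ {k} (i j : Fin k) → Adj (P k) i j ⇔ Adj (P (suc k)) (inject₁ i) (inject₁ j)
P-inject₁-adj i j rewrite toℕ-inject₁ i | toℕ-inject₁ j = ⇔.refl

P-InducedSub-P-suc : ∀ {k} → InducedSub (P k) (P (suc k))
P-InducedSub-P-suc = inject₁ , inject₁-injective , P-inject₁-adj

induced-P₄ : ∀ {a b c d} → Unique (a ∷ b ∷ c ∷ d ∷ []) →
  Adj G a b → Adj G b c → Adj G c d → ¬ Adj G a c → ¬ Adj G b d → ¬ Adj G a d →
  InducedSub (P 4) G
induced-P₄ {G} {a} {b} {c} {d} uniq ab bc cd ¬ac ¬bd ¬ad =
  lookup vs , lookup-injective uniq _ _ , adjacency
  where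
  vs : List (V G)
  vs = a ∷ b ∷ c ∷ d ∷ []
  edge : ∀ {X : Set} → X → T true ⇔ X
  edge x = mk⇔ (λ _ → x) (λ _ → tt)
  non-edge : ∀ {X : Set} → ¬ X → T false ⇔ X
  non-edge ¬x = mk⇔ (λ ()) (λ x → ¬x x)
  flip : ∀ {x y} → ¬ Adj G x y → ¬ Adj G y x
  flip ¬xy yx = ¬xy (Graph.sym G _ _ yx)
  adjacency : ∀ i j → Adj (P 4) i j ⇔ Adj G (lookup vs i) (lookup vs j)
  adjacency 0F 0F = non-edge (irrefl G a)
  adjacency 0F 1F = edge ab
  adjacency 0F 2F = non-edge ¬ac
  adjacency 0F 3F = non-edge ¬ad
  adjacency 1F 0F = edge (Graph.sym G _ _ ab)
  adjacency 1F 1F = non-edge (irrefl G b)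
  adjacency 1F 2F = edge bc
  adjacency 1F 3F = non-edge ¬bd
  adjacency 2F 0F = non-edge (flip ¬ac)
  adjacency 2F 1F = edge (Graph.sym G _ _ bc)
  adjacency 2F 2F = non-edge (irrefl G c)
  adjacency 2F 3F = edge cd
  adjacency 3F 0F = non-edge (flip ¬ad)
  adjacency 3F 1F = non-edge (flip ¬bd)
  adjacency 3F 2F = edge (Graph.sym G _ _ cd)
  adjacency 3F 3F = non-edge (irrefl G d)

module _ {G : Graph} (P₄-free : Free (P 4) G) where

  private
    path : ∀ {u v} xs → Linked (Adj G) (u ∷ xs ++ v ∷ []) → Unique (u ∷ xs ++ v ∷ []) → Path G u v
    path xs l uniq = record { internal = xs ; linked = l ; distinct = uniq }

  -- Shortcut a chord at the start of the path; without one its first four vertices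
  -- would induce a P₄.
  P₄-free-shortcut : ∀ n {u v} xs → length xs ≤ n →
    Linked (Adj G) (u ∷ xs ++ v ∷ []) → Unique (u ∷ xs ++ v ∷ []) →
    Σ[ p ∈ Path G u v ] length (internal p) ≤ 1
  P₄-free-shortcut _ []       _ l uniq = path [] l uniq , z≤n
  P₄-free-shortcut _ (x ∷ []) _ l uniq = path (x ∷ []) l uniq , s≤s z≤n
  P₄-free-shortcut _ {u} {v} (x₁ ∷ x₂ ∷ []) _ (ux₁ ∷ x₁x₂ ∷ x₂v ∷ [-]) uniq
    with T? (adj G u x₂) | T? (adj G x₁ v) | T? (adj G u v)
  ... | yes ux₂ | _ | _ =
    path (x₂ ∷ []) (ux₂ ∷ x₂v ∷ [-]) (Unique-drop (u ∷ []) uniq) , s≤s z≤n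
  ... | no _ | yes x₁v | _ =
    path (x₁ ∷ []) (ux₁ ∷ x₁v ∷ [-]) (Unique-drop (u ∷ x₁ ∷ []) uniq) , s≤s z≤n
  ... | no _ | no _ | yes uv =
    path [] (uv ∷ [-]) (Unique-drop (u ∷ []) (Unique-drop (u ∷ x₁ ∷ []) uniq)) , z≤n
  ... | no ¬ux₂ | no ¬x₁v | no ¬uv =
    ⊥-elim (P₄-free (induced-P₄ {G = G} uniq ux₁ x₁x₂ x₂v ¬ux₂ ¬x₁v ¬uv))
  P₄-free-shortcut (suc n) {u} (x₁ ∷ x₂ ∷ y ∷ r) (s≤s ≤n) (ux₁ ∷ x₁x₂ ∷ x₂y ∷ l) uniq
    with T? (adj G u x₂) | T? (adj G x₁ y) | T? (adj G u y)
  ... | yes ux₂ | _ | _ =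
    P₄-free-shortcut n (x₂ ∷ y ∷ r) ≤n (ux₂ ∷ x₂y ∷ l) (Unique-drop (u ∷ []) uniq)
  ... | no _ | yes x₁y | _ =
    P₄-free-shortcut n (x₁ ∷ y ∷ r) ≤n (ux₁ ∷ x₁y ∷ l) (Unique-drop (u ∷ x₁ ∷ []) uniq)
  ... | no _ | no _ | yes uy =
    P₄-free-shortcut n (y ∷ r) (≤-trans (n≤1+n _) ≤n) (uy ∷ l)
      (Unique-drop (u ∷ []) (Unique-drop (u ∷ x₁ ∷ []) uniq))
  ... | no ¬ux₂ | no ¬x₁y | no ¬uy =
    ⊥-elim (P₄-free (induced-P₄ {G = G} (take⁺ 4 uniq) ux₁ x₁x₂ x₂y ¬ux₂ ¬x₁y ¬uy))

  P₄-free⇒RainbowVertexConnected : Connected G → {C : Set} (c : V G → C) →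
    RainbowVertexConnected G c
  P₄-free⇒RainbowVertexConnected (_ , connected) c u v u≢v =
    rainbow (P₄-free-shortcut _ (internal p) ≤-refl (linked p) (distinct p))
    where
    p : Path G u v
    p = connected u v u≢v
    at-most-one-colour : ∀ xs → length xs ≤ 1 → Unique (map c xs)
    at-most-one-colour []       _         = []
    at-most-one-colour (_ ∷ []) _         = [] ∷ []
    at-most-one-colour (_ ∷ _ ∷ _) (s≤s ())
    rainbow : Σ[ q ∈ Path G u v ] length (internal q) ≤ 1 → Σ[ q ∈ Path G u v ] Rainbow {G} c q
    rainbow (q , short) = q , at-most-one-colour (internal q) short

∃-Vec? : ∀ m {n} {Q : Vec (Fin n) m → Set} → (∀ v → Dec (Q v)) → Dec (Σ (Vec (Fin n) m) Q)
∃-Vec? zero    Q? = map′ ([] ,_) (λ { ([] , q) → q }) (Q? [])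
∃-Vec? (suc m) Q? = map′ (λ (x , v , q) → x ∷ v , q) (λ { (x ∷ v , q) → x , v , q })
  (any? λ x → ∃-Vec? m (λ v → Q? (x ∷ v)))

⇔-dec : Dec A → Dec B → Dec (A ⇔ B)
⇔-dec A? B? = map′ (λ (f , g) → mk⇔ f g) (λ e → Equivalence.to e , Equivalence.from e)
  ((A? →-dec B?) ×-dec (B? →-dec A?))

InducedSub? : ∀ X G → Dec (InducedSub X G)
InducedSub? X G = map′ from-vector to-vector (∃-Vec? (order X) (IsEmbedding? ∘ Vec.lookup))
  where
  IsEmbedding : (V X → V G) → Set
  IsEmbedding f = (∀ i j → f i ≡ f j → i ≡ j) × (∀ i j → Adj X i j ⇔ Adj G (f i) (f j))
  IsEmbedding? : ∀ f → Dec (IsEmbedding f)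
  IsEmbedding? f = all? (λ i → all? λ j → (f i ≟ f j) →-dec (i ≟ j))
    ×-dec all? (λ i → all? λ j → ⇔-dec (T? (adj X i j)) (T? (adj G (f i) (f j))))
  IsEmbedding-resp : ∀ {f g} → (∀ i → f i ≡ g i) → IsEmbedding f → IsEmbedding g
  IsEmbedding-resp f≗g (inj , adj-iff) =
    (λ i j e → inj i j (trans (f≗g i) (trans e (≡.sym (f≗g j))))) ,
    λ i j → subst₂ (λ a b → Adj X i j ⇔ Adj G a b) (f≗g i) (f≗g j) (adj-iff i j)
  from-vector : Σ[ v ∈ Vec (V G) (order X) ] IsEmbedding (Vec.lookup v) → InducedSub X G
  from-vector (v , inj , adj-iff) = Vec.lookup v , inj _ _ , adj-iff
  to-vector : InducedSub X G → Σ[ v ∈ Vec (V G) (order X) ] IsEmbedding (Vec.lookup v)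
  to-vector (f , inj , adj-iff) =
    tabulate f , IsEmbedding-resp (≡.sym ∘ lookup∘tabulate f) ((λ i j → inj) , adj-iff)

K : ℕ → Graph
K n = record
  { order  = n
  ; adj    = λ i j → not ⌊ i ≟ j ⌋
  ; sym    = λ i j h → fromWitnessFalse (toWitnessFalse {a? = i ≟ j} h ∘ ≡.sym)
  ; irrefl = λ i h → toWitnessFalse {a? = i ≟ i} h refl
  }

K-adj : ∀ {n} {i j : Fin n} → i ≢ j → Adj (K n) i j
K-adj i≢j = fromWitnessFalse i≢j

starAdj : ∀ {n} → Fin (suc n) → Fin (suc n) → Bool
starAdj zero    zero    = false
starAdj zero    (suc _) = true
starAdj (suc _) zero    = true
starAdj (suc _) (suc _) = false

Star : ℕ → Graph
Star n = record { order = suc n ; adj = starAdj ; sym = sym′ ; irrefl = irrefl′ }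
  where
  sym′ : ∀ i j → T (starAdj i j) → T (starAdj j i)
  sym′ zero    (suc _) _ = tt
  sym′ (suc _) zero    _ = tt
  irrefl′ : ∀ i → ¬ T (starAdj {n} i i)
  irrefl′ zero    ()
  irrefl′ (suc _) ()

TriangleFree : Graph → Set
TriangleFree G = ∀ x y z → Adj G x y → Adj G y z → Adj G x z → ⊥

Star-triangleFree : ∀ {n} → TriangleFree (Star n)
Star-triangleFree zero    zero    _       ()
Star-triangleFree zero    (suc _) zero    _ _ ()
Star-triangleFree zero    (suc _) (suc _) _ ()
Star-triangleFree (suc _) zero    zero    _ ()
Star-triangleFree (suc _) zero    (suc _) _ _ ()
Star-triangleFree (suc _) (suc _) _       ()

pendantAdj : (C : Graph) {n : ℕ} → (Fin n → V C) → V C ⊎ Fin n → V C ⊎ Fin n → Bool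
pendantAdj C α (inj₁ u) (inj₁ v) = adj C u v
pendantAdj C α (inj₁ u) (inj₂ i) = ⌊ u ≟ α i ⌋
pendantAdj C α (inj₂ i) (inj₁ u) = ⌊ u ≟ α i ⌋
pendantAdj C α (inj₂ _) (inj₂ _) = false

-- C with a new vertex of degree one attached to each α i; the vertex set V C ⊎ Fin n
-- is encoded in Fin (order C + n) through splitAt
withPendants : (C : Graph) {n : ℕ} → (Fin n → V C) → Graph
withPendants C {n} α = record
  { order  = order C + n
  ; adj    = λ x y → pendantAdj C α (split x) (split y)
  ; sym    = λ x y → sym′ (split x) (split y)
  ; irrefl = λ x → irrefl′ (split x)
  }
  where
  split : Fin (order C + n) → V C ⊎ Fin n
  split = splitAt (order C)
  sym′ : ∀ s t → T (pendantAdj C α s t) → T (pendantAdj C α t s)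
  sym′ (inj₁ u) (inj₁ v) = Graph.sym C u v
  sym′ (inj₁ _) (inj₂ _) = id
  sym′ (inj₂ _) (inj₁ _) = id
  irrefl′ : ∀ s → ¬ T (pendantAdj C α s s)
  irrefl′ (inj₁ u) = irrefl C u
  irrefl′ (inj₂ _) ()

module Pendants (C : Graph) {n : ℕ} (α : Fin n → V C) where

  Γ : Graph
  Γ = withPendants C α

  split : V Γ → V C ⊎ Fin n
  split = splitAt (order C)

  core : V C → V Γ
  core u = u ↑ˡ n

  pend : Fin n → V Γ
  pend i = order C ↑ʳ i

  data View (x : V Γ) : Set where
    is-core : ∀ u → core u ≡ x → View x
    is-pend : ∀ i → pend i ≡ x → View x

  view : ∀ x → View x
  view x with split x | join-splitAt (order C) n x
  ... | inj₁ u | e = is-core u e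
  ... | inj₂ i | e = is-pend i e

  core-injective : ∀ {u v} → core u ≡ core v → u ≡ v
  core-injective = ↑ˡ-injective n _ _

  pend-injective : ∀ {i j} → pend i ≡ pend j → i ≡ j
  pend-injective = ↑ʳ-injective (order C) _ _

  private
    split-core : ∀ u → split (core u) ≡ inj₁ u
    split-core u = splitAt-↑ˡ (order C) u n

    split-pend : ∀ i → split (pend i) ≡ inj₂ i
    split-pend = splitAt-↑ʳ (order C) n

    Adj-split : ∀ {x y s t} → split x ≡ s → split y ≡ t →
      Adj Γ x y ⇔ T (pendantAdj C α s t)
    Adj-split refl refl = ⇔.refl

  core≢pend : ∀ {u i} → core u ≢ pend i
  core≢pend {u} {i} e with trans (≡.sym (split-core u)) (trans (cong split e) (split-pend i))
  ... | ()

  pend≢core : ∀ {i u} → pend i ≢ core u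
  pend≢core = ≢-sym core≢pend

  core-adj : ∀ {u v} → Adj Γ (core u) (core v) ⇔ Adj C u v
  core-adj = Adj-split (split-core _) (split-core _)

  anchor-adj : ∀ i → Adj Γ (core (α i)) (pend i)
  anchor-adj i = Equivalence.from (Adj-split (split-core (α i)) (split-pend i)) (fromWitness refl)

  pend-anchor-adj : ∀ i → Adj Γ (pend i) (core (α i))
  pend-anchor-adj i = Graph.sym Γ _ _ (anchor-adj i)

  pend-nbr : ∀ {x i} → Adj Γ x (pend i) → x ≡ core (α i)
  pend-nbr {x} {i} h with view x
  ... | is-core u refl = cong core (toWitness {a? = u ≟ α i}
                           (Equivalence.to (Adj-split (split-core u) (split-pend i)) h))
  ... | is-pend j refl with Equivalence.to (Adj-split (split-pend j) (split-pend i)) h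
  ...   | ()

  pend-nonadj : ∀ i j → ¬ Adj Γ (pend i) (pend j)
  pend-nonadj i j h with Equivalence.to (Adj-split (split-pend i) (split-pend j)) h
  ... | ()

  pend-nbrs-nonadj : ∀ {x y i} → Adj Γ x (pend i) → Adj Γ y (pend i) → ¬ Adj Γ x y
  pend-nbrs-nonadj hx hy xy with pend-nbr hx | pend-nbr hy
  ... | refl | refl = irrefl Γ _ xy

  triangleFree : TriangleFree C → TriangleFree Γ
  triangleFree C-free x y z xy yz xz with view x | view y | view z
  ... | is-pend i refl | _ | _ = pend-nbrs-nonadj (Graph.sym Γ _ _ xy) (Graph.sym Γ _ _ xz) yz
  ... | _ | is-pend j refl | _ = pend-nbrs-nonadj xy (Graph.sym Γ _ _ yz) xz
  ... | _ | _ | is-pend k refl = pend-nbrs-nonadj xz yz xy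
  ... | is-core u refl | is-core v refl | is-core w refl =
    C-free u v w (Equivalence.to core-adj xy) (Equivalence.to core-adj yz)
      (Equivalence.to core-adj xz)

  ¬RvcLe : (∀ {i j} → α i ≡ α j → i ≡ j) → ∀ {r} → r < n → 2 ≤ n → ¬ RvcLe Γ r
  ¬RvcLe _ _ 2≤n (inj₁ complete) =
    pend-nonadj i₀ i₁ (complete _ _ (i₀≢i₁ ∘ pend-injective))
    where
    i₀ i₁ : Fin n
    i₀ = inject≤ 0F 2≤n
    i₁ = inject≤ 1F 2≤n
    i₀≢i₁ : i₀ ≢ i₁
    i₀≢i₁ e with inject≤-injective 2≤n 2≤n 0F 1F e
    ... | ()
  ¬RvcLe α-injective r<n _ (inj₂ (c , rainbow)) with pigeonhole r<n (c ∘ core ∘ α)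
  ... | i , j , i<j , same-colour with rainbow (pend i) (pend j) (<⇒≢ i<j ∘ pend-injective)
  ...   | p , p-rainbow = <⇒≢ i<j (α-injective (core-injective
    (Rainbow-forced c (pend-nonadj i j) (λ h → pend-nbr (Graph.sym Γ _ _ h)) pend-nbr
       p p-rainbow same-colour)))

  IsDiam-pendants : ∀ {d h i₀ i₁} → (∀ x y → DistLe Γ x y (2 + d)) →
    Lipschitz C h → h (α i₀) ≡ 0 → h (α i₁) ≡ d → i₁ ≢ i₀ → IsDiam Γ (2 + d)
  IsDiam-pendants {d} {h} {i₀} {i₁} dist L h₀ h₁ i₁≢i₀ =
    IsDiam-by-Lipschitz dist (λ {x} {y} → lifted-Lipschitz (split x) (split y))
      (trans (cong lifted (split-pend i₀)) lifted-i₀)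
      (trans (cong lifted (split-pend i₁)) lifted-i₁)
    where
    -- a 1-Lipschitz lower bound for the distance from pend i₀
    lifted : V C ⊎ Fin n → ℕ
    lifted (inj₁ u) = suc (h u)
    lifted (inj₂ i) with i ≟ i₀
    ... | yes _ = 0
    ... | no _  = 2 + h (α i)
    lifted-i₀ : lifted (inj₂ i₀) ≡ 0
    lifted-i₀ with i₀ ≟ i₀
    ... | yes _    = refl
    ... | no i₀≢i₀ = ⊥-elim (i₀≢i₀ refl)
    lifted-i₁ : lifted (inj₂ i₁) ≡ 2 + d
    lifted-i₁ with i₁ ≟ i₀
    ... | yes i₁≡i₀ = ⊥-elim (i₁≢i₀ i₁≡i₀)
    ... | no _      = cong (2 +_) h₁
    lifted-Lipschitz : ∀ s t → T (pendantAdj C α s t) → lifted t ≤ suc (lifted s)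
    lifted-Lipschitz (inj₁ u) (inj₁ v) uv = s≤s (L uv)
    lifted-Lipschitz (inj₁ u) (inj₂ i) ui with toWitness {a? = u ≟ α i} ui | i ≟ i₀
    ... | refl | yes _ = z≤n
    ... | refl | no _  = ≤-refl
    lifted-Lipschitz (inj₂ i) (inj₁ u) iu with toWitness {a? = u ≟ α i} iu | i ≟ i₀
    ... | refl | yes refl = s≤s (≤-reflexive h₀)
    ... | refl | no _     = s≤s (m≤n+m _ 2)
    lifted-Lipschitz (inj₂ _) (inj₂ _) ()

H : ℕ → Graph
H n = withPendants (K n) id

module H-Properties (n : ℕ) where
  open Pendants (K n) id public

  clique-adj : ∀ {i j} → i ≢ j → Adj (H n) (core i) (core j)
  clique-adj = Equivalence.from core-adj ∘ K-adj

  H-dist : ∀ x y → DistLe (H n) x y 3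
  H-dist x y with view x | view y
  ... | is-core i refl | is-core j refl with i ≟ j
  ...   | yes refl = inj₁ refl
  ...   | no i≢j   = DistLe-along [] (clique-adj i≢j ∷ [-])
                       ((i≢j ∘ core-injective ∷ []) ∷ [] ∷ []) (s≤s z≤n)
  H-dist x y | is-core i refl | is-pend j refl with i ≟ j
  ...   | yes refl = DistLe-along [] (anchor-adj i ∷ [-]) ((core≢pend ∷ []) ∷ [] ∷ []) (s≤s z≤n)
  ...   | no i≢j   = DistLe-along (core j ∷ []) (clique-adj i≢j ∷ anchor-adj j ∷ [-])
                       ((i≢j ∘ core-injective ∷ core≢pend ∷ []) ∷ (core≢pend ∷ []) ∷ [] ∷ [])
                       (s≤s (s≤s z≤n))
  H-dist x y | is-pend i refl | is-core j refl with i ≟ j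
  ...   | yes refl = DistLe-along [] (pend-anchor-adj i ∷ [-])
                       ((pend≢core ∷ []) ∷ [] ∷ []) (s≤s z≤n)
  ...   | no i≢j   = DistLe-along (core i ∷ []) (pend-anchor-adj i ∷ clique-adj i≢j ∷ [-])
                       ((pend≢core ∷ pend≢core ∷ []) ∷ (i≢j ∘ core-injective ∷ []) ∷ [] ∷ [])
                       (s≤s (s≤s z≤n))
  H-dist x y | is-pend i refl | is-pend j refl with i ≟ j
  ...   | yes refl = inj₁ refl
  ...   | no i≢j   = DistLe-along (core i ∷ core j ∷ [])
                       (pend-anchor-adj i ∷ clique-adj i≢j ∷ anchor-adj j ∷ [-])
                       ((pend≢core ∷ pend≢core ∷ i≢j ∘ pend-injective ∷ []) ∷
                        (i≢j ∘ core-injective ∷ core≢pend ∷ []) ∷ (core≢pend ∷ []) ∷ [] ∷ [])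
                       (s≤s (s≤s (s≤s z≤n)))

H-IsDiam : ∀ m → IsDiam (H (2 + m)) 3
H-IsDiam m = IsDiam-pendants {i₀ = 0F} {i₁ = 1F} H-dist L refl refl (λ ())
  where
  open H-Properties (2 + m)
  h : Fin (2 + m) → ℕ
  h 0F      = 0
  h (suc _) = 1
  L : Lipschitz (K (2 + m)) h
  L {y = 0F}    _ = z≤n
  L {y = suc _} _ = s≤s z≤n

H-Connected : ∀ n → 1 ≤ n → Connected (H n)
H-Connected n 1≤n = DistLe⇒Connected (≤-trans 1≤n (m≤m+n n n)) (H-Properties.H-dist n)

H-¬RvcLe : ∀ k → ¬ RvcLe (H (4 + k)) (3 + k)
H-¬RvcLe k = H-Properties.¬RvcLe (4 + k) id ≤-refl (s≤s (s≤s z≤n))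

S : ℕ → Graph
S n = withPendants (Star n) suc

module S-Properties (n : ℕ) where
  open Pendants (Star n) suc public

  hub : V (S n)
  hub = core 0F

  mid : Fin n → V (S n)
  mid i = core (suc i)

  hub-mid : ∀ i → Adj (S n) hub (mid i)
  hub-mid i = Equivalence.from (core-adj {0F} {suc i}) tt

  mid-hub : ∀ i → Adj (S n) (mid i) hub
  mid-hub i = Equivalence.from (core-adj {suc i} {0F}) tt

  hub≢mid : ∀ {i} → hub ≢ mid i
  hub≢mid e with core-injective e
  ... | ()

  mid≢hub : ∀ {i} → mid i ≢ hub
  mid≢hub = ≢-sym hub≢mid

  mid≢mid : ∀ {i j} → i ≢ j → mid i ≢ mid j
  mid≢mid i≢j = i≢j ∘ suc-injective ∘ core-injective

  S-dist : ∀ x y → DistLe (S n) x y 4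
  S-dist x y with view x | view y
  ... | is-core 0F refl | is-core 0F refl = inj₁ refl
  ... | is-core 0F refl | is-core (suc j) refl =
    DistLe-along [] (hub-mid j ∷ [-]) ((hub≢mid ∷ []) ∷ [] ∷ []) (s≤s z≤n)
  ... | is-core (suc i) refl | is-core 0F refl =
    DistLe-along [] (mid-hub i ∷ [-]) ((mid≢hub ∷ []) ∷ [] ∷ []) (s≤s z≤n)
  ... | is-core 0F refl | is-pend j refl =
    DistLe-along (mid j ∷ []) (hub-mid j ∷ anchor-adj j ∷ [-])
      ((hub≢mid ∷ core≢pend ∷ []) ∷ (core≢pend ∷ []) ∷ [] ∷ []) (s≤s (s≤s z≤n))
  ... | is-pend i refl | is-core 0F refl =
    DistLe-along (mid i ∷ []) (pend-anchor-adj i ∷ mid-hub i ∷ [-])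
      ((pend≢core ∷ pend≢core ∷ []) ∷ (mid≢hub ∷ []) ∷ [] ∷ []) (s≤s (s≤s z≤n))
  S-dist x y | is-core (suc i) refl | is-core (suc j) refl with i ≟ j
  ... | yes refl = inj₁ refl
  ... | no i≢j   = DistLe-along (hub ∷ []) (mid-hub i ∷ hub-mid j ∷ [-])
                     ((mid≢hub ∷ mid≢mid i≢j ∷ []) ∷ (hub≢mid ∷ []) ∷ [] ∷ []) (s≤s (s≤s z≤n))
  S-dist x y | is-core (suc i) refl | is-pend j refl with i ≟ j
  ... | yes refl = DistLe-along [] (anchor-adj i ∷ [-]) ((core≢pend ∷ []) ∷ [] ∷ []) (s≤s z≤n)
  ... | no i≢j   = DistLe-along (hub ∷ mid j ∷ []) (mid-hub i ∷ hub-mid j ∷ anchor-adj j ∷ [-])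
                     ((mid≢hub ∷ mid≢mid i≢j ∷ core≢pend ∷ []) ∷ (hub≢mid ∷ core≢pend ∷ []) ∷
                      (core≢pend ∷ []) ∷ [] ∷ [])
                     (s≤s (s≤s (s≤s z≤n)))
  S-dist x y | is-pend i refl | is-core (suc j) refl with i ≟ j
  ... | yes refl = DistLe-along [] (pend-anchor-adj i ∷ [-]) ((pend≢core ∷ []) ∷ [] ∷ []) (s≤s z≤n)
  ... | no i≢j   = DistLe-along (mid i ∷ hub ∷ []) (pend-anchor-adj i ∷ mid-hub i ∷ hub-mid j ∷ [-])
                     ((pend≢core ∷ pend≢core ∷ pend≢core ∷ []) ∷ (mid≢hub ∷ mid≢mid i≢j ∷ []) ∷
                      (hub≢mid ∷ []) ∷ [] ∷ [])
                     (s≤s (s≤s (s≤s z≤n)))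
  S-dist x y | is-pend i refl | is-pend j refl with i ≟ j
  ... | yes refl = inj₁ refl
  ... | no i≢j   = DistLe-along (mid i ∷ hub ∷ mid j ∷ [])
                     (pend-anchor-adj i ∷ mid-hub i ∷ hub-mid j ∷ anchor-adj j ∷ [-])
                     ((pend≢core ∷ pend≢core ∷ pend≢core ∷ i≢j ∘ pend-injective ∷ []) ∷
                      (mid≢hub ∷ mid≢mid i≢j ∷ core≢pend ∷ []) ∷ (hub≢mid ∷ core≢pend ∷ []) ∷
                      (core≢pend ∷ []) ∷ [] ∷ [])
                     ≤-refl

S-IsDiam : ∀ m → IsDiam (S (2 + m)) 4
S-IsDiam m = IsDiam-pendants {i₀ = 0F} {i₁ = 1F} S-dist L refl refl (λ ())
  where
  open S-Properties (2 + m)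
  h : Fin (3 + m) → ℕ
  h 0F            = 1
  h 1F            = 0
  h (suc (suc _)) = 2
  L : Lipschitz (Star (2 + m)) h
  L {0F}    {0F}            ()
  L {0F}    {1F}            _ = z≤n
  L {0F}    {suc (suc _)}   _ = ≤-refl
  L {suc _} {0F}            _ = s≤s z≤n
  L {suc _} {suc _}         ()

S-Connected : ∀ n → Connected (S n)
S-Connected n = DistLe⇒Connected (s≤s z≤n) (S-Properties.S-dist n)

S-¬RvcLe : ∀ k → ¬ RvcLe (S (5 + k)) (4 + k)
S-¬RvcLe k = S-Properties.¬RvcLe (5 + k) suc-injective ≤-refl (s≤s (s≤s z≤n))

S-triangleFree : ∀ n → TriangleFree (S n)
S-triangleFree n = S-Properties.triangleFree n Star-triangleFree

InducedSub-factor : ∀ {X Y Z} (κ : InducedSub X Z) (e : InducedSub Y Z) →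
  (∀ x → ∃[ y ] proj₁ e y ≡ proj₁ κ x) →
  Σ[ f ∈ InducedSub X Y ] (∀ x → proj₁ e (proj₁ f x) ≡ proj₁ κ x)
InducedSub-factor {X} {Y} {Z} (κ , κ-injective , κ-adj) (e , _ , e-adj) κ⊆e =
  (f , f-injective , f-adj) , proj₂ ∘ κ⊆e
  where
  f : V X → V Y
  f = proj₁ ∘ κ⊆e
  f-injective : ∀ {x y} → f x ≡ f y → x ≡ y
  f-injective {x} {y} fx≡fy =
    κ-injective (trans (≡.sym (proj₂ (κ⊆e x))) (trans (cong e fx≡fy) (proj₂ (κ⊆e y))))
  f-adj : ∀ x y → Adj X x y ⇔ Adj Y (f x) (f y)
  f-adj x y = ⇔.trans (κ-adj x y) (⇔.sym
    (subst₂ (λ a b → Adj Y (f x) (f y) ⇔ Adj Z a b) (proj₂ (κ⊆e x)) (proj₂ (κ⊆e y))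
      (e-adj (f x) (f y))))

≅-of-same-image : ∀ {X Y Z} (κ : InducedSub X Z) (e : InducedSub Y Z) →
  (∀ x → ∃[ y ] proj₁ e y ≡ proj₁ κ x) → (∀ y → ∃[ x ] proj₁ κ x ≡ proj₁ e y) → X ≅ Y
≅-of-same-image {X} {Y} {Z} κ e κ⊆e e⊆κ
  with InducedSub-factor {X} {Y} {Z} κ e κ⊆e | InducedSub-factor {Y} {X} {Z} e κ e⊆κ
... | (to , _ , to-adj) , to-commutes | (from , _ , _) , from-commutes = record
  { to      = to
  ; from    = from
  ; from∘to = λ x → proj₁ (proj₂ κ) (trans (from-commutes (to x)) (to-commutes x))
  ; to∘from = λ y → proj₁ (proj₂ e) (trans (to-commutes (from y)) (from-commutes y))
  ; adj-iff = to-adj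
  }

three-into-two : {a b : A} (w : Fin 3 → A) → (∀ {k l} → w k ≡ w l → k ≡ l) →
  (∀ k → w k ≡ a ⊎ w k ≡ b) → ⊥
three-into-two w w-injective cover with cover 0F | cover 1F | cover 2F
... | inj₁ p | inj₁ q | _      = contradiction (w-injective (trans p (≡.sym q))) λ ()
... | inj₂ p | inj₂ q | _      = contradiction (w-injective (trans p (≡.sym q))) λ ()
... | inj₁ p | inj₂ _ | inj₁ r = contradiction (w-injective (trans p (≡.sym r))) λ ()
... | inj₂ p | inj₁ _ | inj₂ r = contradiction (w-injective (trans p (≡.sym r))) λ ()
... | inj₁ _ | inj₂ q | inj₂ r = contradiction (w-injective (trans q (≡.sym r))) λ ()
... | inj₂ _ | inj₁ q | inj₁ r = contradiction (w-injective (trans q (≡.sym r))) λ ()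

P₄-InducedSub-classification : ∀ {X} (κ : InducedSub X (P 4)) →
  ∃[ x ] proj₁ κ x ≡ 1F → ∃[ x ] proj₁ κ x ≡ 2F →
  (v : Fin 3 → V X) → (∀ {k l} → v k ≡ v l → k ≡ l) → (X ≅ P 3) ⊎ (X ≅ P 4)
P₄-InducedSub-classification {X} κ@(f , f-injective , _) (x₁ , f₁) (x₂ , f₂) v v-injective
  with any? (λ x → f x ≟ 0F) | any? (λ x → f x ≟ 3F)
... | yes (x₀ , f₀) | yes (x₃ , f₃) =
  inj₂ (≅-of-same-image {Z = P 4} κ (id , id , λ _ _ → ⇔.refl) (λ x → f x , refl) preimage)
  where
  preimage : ∀ c → ∃[ x ] f x ≡ c
  preimage 0F = x₀ , f₀
  preimage 1F = x₁ , f₁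
  preimage 2F = x₂ , f₂
  preimage 3F = x₃ , f₃
... | no ¬0 | yes (x₃ , f₃) =
  inj₁ (≅-of-same-image {Z = P 4} κ (suc , suc-injective , P-suc-adj) image preimage)
  where
  image : ∀ x → ∃[ c ] suc c ≡ f x
  image x with f x in eq
  ... | 0F    = ⊥-elim (¬0 (x , eq))
  ... | suc c = c , refl
  preimage : ∀ c → ∃[ x ] f x ≡ suc c
  preimage 0F = x₁ , f₁
  preimage 1F = x₂ , f₂
  preimage 2F = x₃ , f₃
... | yes (x₀ , f₀) | no ¬3 =
  inj₁ (≅-of-same-image {Z = P 4} κ P-InducedSub-P-suc image preimage)
  where
  image : ∀ x → ∃[ c ] inject₁ c ≡ f x
  image x with f x in eq
  ... | 0F = 0F , refl
  ... | 1F = 1F , refl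
  ... | 2F = 2F , refl
  ... | 3F = ⊥-elim (¬3 (x , eq))
  preimage : ∀ c → ∃[ x ] f x ≡ inject₁ c
  preimage 0F = x₀ , f₀
  preimage 1F = x₁ , f₁
  preimage 2F = x₂ , f₂
... | no ¬0 | no ¬3 = ⊥-elim (three-into-two (f ∘ v) (v-injective ∘ f-injective) middle)
  where
  middle : ∀ k → f (v k) ≡ 1F ⊎ f (v k) ≡ 2F
  middle k with f (v k) in eq
  ... | 0F = ⊥-elim (¬0 (v k , eq))
  ... | 1F = inj₁ refl
  ... | 2F = inj₂ refl
  ... | 3F = ⊥-elim (¬3 (v k , eq))

module TriangleFree-InducedSub-H {X : Graph} {n : ℕ}
  (X-triangleFree : TriangleFree X) (X-nbr : ∀ x → ∃[ y ] Adj X x y)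
  (v : Fin 3 → V X) (v-injective : ∀ {k l} → v k ≡ v l → k ≡ l)
  (g-embedding : InducedSub X (H n)) where

  open H-Properties n

  g : V X → V (H n)
  g = proj₁ g-embedding

  g-injective : ∀ {x y} → g x ≡ g y → x ≡ y
  g-injective = proj₁ (proj₂ g-embedding)

  g-reflects : ∀ {x y a b} → g x ≡ a → g y ≡ b → Adj (H n) a b → Adj X x y
  g-reflects {x} {y} refl refl = Equivalence.from (proj₂ (proj₂ g-embedding) x y)

  OnRow : Fin n → V X → Set
  OnRow t x = g x ≡ core t ⊎ g x ≡ pend t

  Hit : Fin n → Set
  Hit t = ∃[ y ] g y ≡ core t

  -- a pendant of H in the image forces its anchor into the image, as x has a neighbour
  row : ∀ x → Σ[ t ∈ Fin n ] OnRow t x × Hit t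
  row x with view (g x)
  ... | is-core t e = t , inj₁ (≡.sym e) , x , ≡.sym e
  ... | is-pend t e = t , inj₂ (≡.sym e) , y , pend-nbr (subst (Adj (H n) (g y)) (≡.sym e) gy~gx)
    where
    y = proj₁ (X-nbr x)
    gy~gx : Adj (H n) (g y) (g x)
    gy~gx = Graph.sym (H n) _ _ (Equivalence.to (proj₂ (proj₂ g-embedding) x y) (proj₂ (X-nbr x)))

  two-rows : Σ[ i ∈ Fin n ] Σ[ j ∈ Fin n ] i ≢ j × Hit i × Hit j
  two-rows with row (v 0F) | row (v 1F) | row (v 2F)
  ... | i , on₀ , hit-i | t₁ , on₁ , hit₁ | t₂ , on₂ , hit₂ with t₁ ≟ i | t₂ ≟ i
  ...   | no t₁≢i  | _        = i , t₁ , ≢-sym t₁≢i , hit-i , hit₁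
  ...   | yes _    | no t₂≢i  = i , t₂ , ≢-sym t₂≢i , hit-i , hit₂
  ...   | yes refl | yes refl = ⊥-elim (three-into-two (g ∘ v) (v-injective ∘ g-injective) on-i)
    where
    on-i : ∀ k → OnRow i (v k)
    on-i 0F = on₀
    on-i 1F = on₁
    on-i 2F = on₂

  i j : Fin n
  i = proj₁ two-rows
  j = proj₁ (proj₂ two-rows)

  i≢j : i ≢ j
  i≢j = proj₁ (proj₂ (proj₂ two-rows))

  hit-i : Hit i
  hit-i = proj₁ (proj₂ (proj₂ (proj₂ two-rows)))

  hit-j : Hit j
  hit-j = proj₂ (proj₂ (proj₂ (proj₂ two-rows)))

  -- a third row would give three pairwise adjacent clique vertices
  only-two-rows : ∀ t → Hit t → t ≡ i ⊎ t ≡ j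
  only-two-rows t (z , gz) with t ≟ i | t ≟ j | hit-i | hit-j
  ... | yes t≡i | _       | _ | _ = inj₁ t≡i
  ... | no _    | yes t≡j | _ | _ = inj₂ t≡j
  ... | no t≢i  | no t≢j  | x , gx | y , gy = ⊥-elim (X-triangleFree x y z
    (g-reflects gx gy (clique-adj i≢j))
    (g-reflects gy gz (clique-adj (t≢j ∘ ≡.sym)))
    (g-reflects gx gz (clique-adj (t≢i ∘ ≡.sym))))

  spine-list : List (V (H n))
  spine-list = pend i ∷ core i ∷ core j ∷ pend j ∷ []

  spine : InducedSub (P 4) (H n)
  spine = induced-P₄ {G = H n}
    ((pend≢core ∷ pend≢core ∷ i≢j ∘ pend-injective ∷ []) ∷
     (i≢j ∘ core-injective ∷ core≢pend ∷ []) ∷ (core≢pend ∷ []) ∷ [] ∷ [])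
    (pend-anchor-adj i) (clique-adj i≢j) (anchor-adj j)
    (λ h → i≢j (core-injective (≡.sym (pend-nbr (Graph.sym (H n) _ _ h)))))
    (λ h → i≢j (core-injective (pend-nbr h)))
    (pend-nonadj i j)

  spine-covers : ∀ x → ∃[ c ] lookup spine-list c ≡ g x
  spine-covers x with row x
  ... | t , on-t , hit-t with only-two-rows t hit-t | on-t
  ...   | inj₁ refl | inj₁ gx≡core = 1F , ≡.sym gx≡core
  ...   | inj₁ refl | inj₂ gx≡pend = 0F , ≡.sym gx≡pend
  ...   | inj₂ refl | inj₁ gx≡core = 2F , ≡.sym gx≡core
  ...   | inj₂ refl | inj₂ gx≡pend = 3F , ≡.sym gx≡pend

  classification : (X ≅ P 3) ⊎ (X ≅ P 4)
  classification with InducedSub-factor {X} {P 4} {H n} g-embedding spine spine-covers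
  ... | κ , κ-commutes = P₄-InducedSub-classification κ
    (proj₁ hit-i , spine-hit 1F hit-i) (proj₁ hit-j , spine-hit 2F hit-j) v v-injective
    where
    spine-hit : ∀ c → (hit : ∃[ y ] g y ≡ lookup spine-list c) → proj₁ κ (proj₁ hit) ≡ c
    spine-hit c (y , gy) = proj₁ (proj₂ spine) (trans (κ-commutes y) gy)

Connected⇒nbr : Connected G → ∀ {x y} → x ≢ y → ∃[ w ] Adj G x w
Connected⇒nbr {G} (_ , connected) {x} {y} x≢y = nbr (first-edge x (internal p) y (linked p))
  where
  p : Path G x y
  p = connected x y x≢y
  nbr : Adj G x y ⊎ ∃[ w ] (w ∈ internal p × Adj G x w) → ∃[ w ] Adj G x w
  nbr (inj₁ xy)          = y , xy
  nbr (inj₂ (w , _ , xw)) = w , xw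

triangle⇒Free : ∀ {X x y z} → TriangleFree G → Adj X x y → Adj X y z → Adj X x z → Free X G
triangle⇒Free {G} {x = x} {y} {z} G-triangleFree xy yz xz (f , _ , f-adj) =
  G-triangleFree (f x) (f y) (f z)
    (Equivalence.to (f-adj x y) xy) (Equivalence.to (f-adj y z) yz) (Equivalence.to (f-adj x z) xz)

RvcBound : Graph → Set
RvcBound X = Σ ℕ λ k → (G : Graph) → Connected G → Free X G →
  (d : ℕ) → IsDiam G d → RvcLe G (d + k)

RvcBound⇒≅P₃⊎≅P₄ : ∀ X → Connected X → 3 ≤ order X → RvcBound X → (X ≅ P 3) ⊎ (X ≅ P 4)
RvcBound⇒≅P₃⊎≅P₄ X X-connected 3≤∣X∣ (k , bound) with InducedSub? X (H (4 + k))
... | no X∉H  = ⊥-elim (H-¬RvcLe k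
  (bound (H (4 + k)) (H-Connected (4 + k) (s≤s z≤n)) X∉H 3 (H-IsDiam (2 + k))))
... | yes X⊆H = TriangleFree-InducedSub-H.classification {X} {4 + k} X-triangleFree X-nbr v
  (λ {a} {b} → inject≤-injective 3≤∣X∣ 3≤∣X∣ a b) X⊆H
  where
  X-triangleFree : TriangleFree X
  X-triangleFree x y z xy yz xz = S-¬RvcLe k (bound (S (5 + k)) (S-Connected (5 + k))
    (triangle⇒Free {S (5 + k)} {X} (S-triangleFree (5 + k)) xy yz xz) 4 (S-IsDiam (3 + k)))
  v : Fin 3 → V X
  v a = inject≤ a 3≤∣X∣
  X-nbr : ∀ x → ∃[ y ] Adj X x y
  X-nbr x with x ≟ v 0F
  ... | yes refl = Connected⇒nbr {X} X-connected {y = v 1F} λ e →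
    contradiction (inject≤-injective 3≤∣X∣ 3≤∣X∣ 0F 1F e) λ ()
  ... | no x≢v₀  = Connected⇒nbr {X} X-connected x≢v₀

≅P₃⊎≅P₄⇒InducedSub-P₄ : ∀ {X} → (X ≅ P 3) ⊎ (X ≅ P 4) → InducedSub X (P 4)
≅P₃⊎≅P₄⇒InducedSub-P₄ {X} (inj₁ X≅P₃) =
  InducedSub-trans {X} {P 3} {P 4} (≅⇒InducedSub X≅P₃) P-InducedSub-P-suc
≅P₃⊎≅P₄⇒InducedSub-P₄ (inj₂ X≅P₄) = ≅⇒InducedSub X≅P₄

≅P₃⊎≅P₄⇒RvcBound : ∀ X → (X ≅ P 3) ⊎ (X ≅ P 4) → RvcBound X
≅P₃⊎≅P₄⇒RvcBound X X≅P = 1 , λ G G-connected X-free d _ →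
  inj₂ ((λ _ → d ↑ʳ 0F) , P₄-free⇒RainbowVertexConnected {G}
    (X-free ∘ InducedSub-trans {X} {P 4} {G} (≅P₃⊎≅P₄⇒InducedSub-P₄ X≅P)) G-connected _)

theorem5 : (X : Graph) → Connected X → 3 ≤ order X →
    (Σ ℕ (λ k → (G : Graph) → Connected G → Free X G →
        (d : ℕ) → IsDiam G d → RvcLe G (d + k)))
    ⇔ ((X ≅ P 3) ⊎ (X ≅ P 4))
theorem5 X X-connected 3≤∣X∣ =
  mk⇔ (RvcBound⇒≅P₃⊎≅P₄ X X-connected 3≤∣X∣) (≅P₃⊎≅P₄⇒RvcBound X)
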